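{- For each natural number $n\geq1$, let $V_n=\{a_1,\dots,a_n\}$ be an alphabet of $n$ pairwise different letters and $L_{5,n}=V_n^*$. Then $L_{5,n}\in\mathrm{SLT}_1\setminus\mathrm{RL}_n^P$ for every $n\geq1$.
   Context: A right-linear grammar is $(N,T,P,S)$ with rules of the form $A\to wB$ or $A\to w$, $A,B\in N$, $w\in T^*$; $\mathrm{RL}_n^P$ is the family of regular languages generated by some right-linear grammar with at most $n$ production rules. For $k\geq1$, a language $L$ over an alphabet $V$ is strictly locally $k$-testable (family $\mathrm{SLT}_k$) if there are sets $B,I,E\subseteq V^k$ and a finite set $F$ of words of length at most $k-1$ such that $L$ consists of the words of $F$ together with exactly those words $a_1a_2\cdots a_m$ ($m\geq k$, $a_i\in V$) for which $a_1\cdots a_k\in B$, $a_{j+1}\cdots a_{j+k}\in I$ for every $j$ with $1\leq j\leq m-k-1$, and $a_{m-k+1}\cdots a_m\in E$. -}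

module Defs where

open import Data.Nat using (ℕ; _≤_; _<_; _∸_)
open import Data.Fin using (Fin)
open import Data.List using (List; length; _++_)
open import Data.List.Membership.Propositional using (_∈_)
open import Data.List.Relation.Unary.All using (All)
open import Data.Vec using (Vec; toList)
open import Data.Maybe using (Maybe; just; nothing)
open import Data.Product using (Σ; _×_; _,_)
open import Data.Sum using (_⊎_)
open import Data.Unit using (⊤)
open import Function.Bundles using (_⇔_)
open import Relation.Binary.PropositionalEquality using (_≡_)

Language : Set → Set₁
Language A = List A → Set

-- Right-linear grammars with terminal alphabet A and nonterminals Fin k.
-- A rule  X → w Y  is  mkRule X w (just Y);  a rule  X → w  is
-- mkRule X w nothing.

record Rule (k : ℕ) (A : Set) : Set where
  constructor mkRule
  field
    lhs  : Fin k
    word : List A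
    next : Maybe (Fin k)

record RLGrammar (A : Set) : Set where
  field
    nNonterm : ℕ
    rules    : List (Rule nNonterm A)
    start    : Fin nNonterm

data Derives {A : Set} (G : RLGrammar A) :
       Fin (RLGrammar.nNonterm G) → List A → Set where
  stop : ∀ {X w} → mkRule X w nothing ∈ RLGrammar.rules G → Derives G X w
  step : ∀ {X Y u v} → mkRule X u (just Y) ∈ RLGrammar.rules G →
         Derives G Y v → Derives G X (u ++ v)

LangOf : {A : Set} → RLGrammar A → Language A
LangOf G = Derives G (RLGrammar.start G)

RLP : {A : Set} → ℕ → Language A → Set
RLP {A} n L = Σ (RLGrammar A) λ G →
  (length (RLGrammar.rules G) ≤ n) × (∀ w → L w ⇔ LangOf G w)

-- The word w satisfies the (B, I, E)-conditions for k (assuming |w| ≥ k).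
-- Windows are expressed through factorizations w = u ++ x ++ v with
-- x ∈ V^k; the window a_{j+1}…a_{j+k} has j = |u|.
SLTCond : {A : Set} (k : ℕ) (B I E : Vec A k → Set) → List A → Set
SLTCond {A} k B I E w =
  (k ≤ length w)
  × (Σ (Vec A k) λ x → Σ (List A) λ v → (w ≡ toList x ++ v) × B x)
  × (∀ (u : List A) (x : Vec A k) (v : List A) → w ≡ u ++ toList x ++ v →
       1 ≤ length u → length u ≤ length w ∸ k ∸ 1 → I x)
  × (Σ (List A) λ u → Σ (Vec A k) λ x → (w ≡ u ++ toList x) × E x)

SLT : {A : Set} → ℕ → Language A → Set₁
SLT {A} k L =
  Σ (Vec A k → Set) λ B → Σ (Vec A k → Set) λ I → Σ (Vec A k → Set) λ E →
  Σ (List (List A)) λ F → All (λ u → length u < k) F ×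
  (∀ w → L w ⇔ (w ∈ F ⊎ SLTCond k B I E w))

-- V_n = Fin n (n pairwise different letters), L_{5,n} = V_n^*.

L5 : (n : ℕ) → Language (Fin n)
L5 n w = ⊤

-- V* is strictly locally 1-testable with every window allowed.  A right-linear
-- grammar derives a word of length at most 1 only through a rule whose terminal
-- word is that very word; V_n* contains n + 1 such words, so every grammar for
-- it has at least n + 1 rules.
module Submission where

open import Defs
open import Data.Nat using (ℕ; suc; _≤_; s≤s; z≤n)
open import Data.Nat.Properties using (1+n≰n; ≤-trans)
open import Data.Fin using (Fin; zero; suc)
open import Data.Fin.Properties using (injective⇒≤)
open import Data.List using (List; []; _∷_; _∷ʳ_; length; map)
open import Data.List.Properties using (length-map)
open import Data.List.Membership.Propositional using (_∈_)
open import Data.List.Membership.Propositional.Properties using (∈-map⁺)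
open import Data.List.Membership.Setoid.Properties using (index-injective)
open import Data.List.Relation.Unary.Any using (here)
open import Data.List.Relation.Unary.All using ([]; _∷_)
import Data.Vec as Vec
open import Data.Product using (Σ; _×_; _,_)
open import Data.Sum using (_⊎_; inj₁; inj₂)
open import Data.Unit using (⊤; tt)
open import Function.Bundles using (mk⇔; Equivalence)
open import Function.Definitions using (Injective)
open import Relation.Nullary using (¬_)
open import Relation.Binary.PropositionalEquality using (_≡_; refl; setoid; cong; subst)

injective⇒≤length : {A : Set} {m : ℕ} {xs : List A} (f : Fin m → A) →
  Injective _≡_ _≡_ f → (∀ i → f i ∈ xs) → m ≤ length xs
injective⇒≤length f f-inj f∈xs =
  injective⇒≤ λ {i} {j} eq → f-inj (index-injective (setoid _) (f∈xs i) (f∈xs j) eq)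

∷-≡-∷ʳ : {A : Set} (a : A) (v : List A) → Σ (List A) λ u → Σ A λ b → a ∷ v ≡ u ∷ʳ b
∷-≡-∷ʳ a []      = [] , a , refl
∷-≡-∷ʳ a (c ∷ v) with ∷-≡-∷ʳ c v
... | u , b , c∷v≡u∷ʳb = a ∷ u , b , cong (a ∷_) c∷v≡u∷ʳb

universal-SLT₁ : {A : Set} → SLT {A} 1 (λ _ → ⊤)
universal-SLT₁ {A} = all , all , all , [] ∷ [] , s≤s z≤n ∷ [] , λ w → mk⇔ (classify w) _
  where
  all : Vec.Vec A 1 → Set
  all _ = ⊤

  classify : ∀ w → ⊤ → w ∈ [] ∷ [] ⊎ SLTCond 1 all all all w
  classify [] _ = inj₁ (here refl)
  classify (a ∷ v) _ with ∷-≡-∷ʳ a v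
  ... | u , b , a∷v≡u∷ʳb =
    inj₂ (s≤s z≤n , (a Vec.∷ Vec.[] , v , refl , tt) , _ , (u , b Vec.∷ Vec.[] , a∷v≡u∷ʳb , tt))

module _ {A : Set} (G : RLGrammar A) where
  open RLGrammar G

  ruleWords : List (List A)
  ruleWords = map Rule.word rules

  -- A derivation of a word of length at most 1 uses one rule carrying the
  -- whole word, all other rules along it carrying the empty word.
  short-derivable⇒∈ruleWords : ∀ {X w} → Derives G X w → length w ≤ 1 → w ∈ ruleWords
  short-derivable⇒∈ruleWords (stop X→w) _                               = ∈-map⁺ Rule.word X→w
  short-derivable⇒∈ruleWords (step {u = []} _ Y⇒w) |w|≤1                = short-derivable⇒∈ruleWords Y⇒w |w|≤1
  short-derivable⇒∈ruleWords (step {u = _ ∷ []} {[]} X→aY _) _          = ∈-map⁺ Rule.word X→aY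
  short-derivable⇒∈ruleWords (step {u = _ ∷ []} {_ ∷ _} _ _) (s≤s ())
  short-derivable⇒∈ruleWords (step {u = _ ∷ _ ∷ _} _ _) (s≤s ())

  short-words≤#rules : {m : ℕ} (f : Fin m → List A) → Injective _≡_ _≡_ f →
    (∀ i → length (f i) ≤ 1) → (∀ i → LangOf G (f i)) → m ≤ length rules
  short-words≤#rules f f-inj |f|≤1 f∈L =
    subst (_ ≤_) (length-map Rule.word rules)
      (injective⇒≤length f f-inj λ i → short-derivable⇒∈ruleWords (f∈L i) (|f|≤1 i))

wordOfLength≤1 : {n : ℕ} → Fin (suc n) → List (Fin n)
wordOfLength≤1 zero    = []
wordOfLength≤1 (suc a) = a ∷ []

wordOfLength≤1-injective : {n : ℕ} → Injective _≡_ _≡_ (wordOfLength≤1 {n})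
wordOfLength≤1-injective {x = zero}  {zero}  _    = refl
wordOfLength≤1-injective {x = suc a} {suc a} refl = refl

wordOfLength≤1-length : {n : ℕ} (i : Fin (suc n)) → length (wordOfLength≤1 i) ≤ 1
wordOfLength≤1-length zero    = z≤n
wordOfLength≤1-length (suc _) = s≤s z≤n

universal-∉RLP : (n : ℕ) → ¬ RLP n (λ (_ : List (Fin n)) → ⊤)
universal-∉RLP n (G , #rules≤n , L⇔G) =
  1+n≰n (≤-trans (short-words≤#rules G wordOfLength≤1 wordOfLength≤1-injective
                    wordOfLength≤1-length (λ i → Equivalence.to (L⇔G _) tt))
                 #rules≤n)

lemma5 : (n : ℕ) → 1 ≤ n → SLT 1 (L5 n) × ¬ RLP n (L5 n)
lemma5 n _ = universal-SLT₁ , universal-∉RLP n
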